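{- Let $n\geqslant 5$ and let $i,k\in\{1,\dots,n-1\}$ with $k\geqslant 2$ and $i\notin\{k-2,k-1,k,k+1\}$. Then $BS_n$ has a maximal cover by $6$-prisms of the canonical form $(b_k\,b_i\,b_{k-1}\,b_i)^3$; that is, the vertex set of $BS_n$ can be partitioned into sets of the form $\{\pi w,\ \pi w b_i : w\in\langle b_{k-1},b_k\rangle\}$, each of which, together with the $b_{k-1}$-, $b_k$- and $b_i$-edges of $BS_n$ among its vertices, forms a subgraph isomorphic to the $6$-prism $C_6\times K_2$ (two $6$-cycles $(b_kb_{k-1})^3$ joined by six $b_i$-edges).
   Context: $Sym_n$ is the symmetric group of permutations of $\{1,\dots,n\}$; $b_i=(i\ i+1)$ for $1\leqslant i\leqslant n-1$, acting by right multiplication (swapping positions $i$ and $i+1$). The Bubble-sort graph $BS_n=Cay(Sym_n,\{b_1,\dots,b_{n-1}\})$ has $\pi$ adjacent to $\pi b_i$. The $m$-prism is the graph $C_m\times K_2$: two disjoint $m$-cycles $(u_1,\dots,u_m)$, $(v_1,\dots,v_m)$ plus edges $u_tv_t$. A maximal cover of a graph by copies of $H$ is a collection of vertex-disjoint subgraphs isomorphic to $H$ covering every vertex. -}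

module Defs where

open import Data.Nat using (ℕ; zero; suc; _∸_; _%_; _+_)
open import Data.Fin using (Fin; toℕ)
open import Data.Vec using (Vec; []; _∷_; lookup)
open import Data.List using (List; []; _∷_; length)
import Data.List as L
open import Data.Product using (Σ; _×_; _,_; ∃; ∃-syntax)
open import Data.Sum using (_⊎_)
open import Relation.Binary.PropositionalEquality using (_≡_; _≢_)
open import Function.Bundles using (_⇔_)

-- Elements of Sym_n in one-line notation: π is the vector (π(1),…,π(n)),
-- with 0-indexed positions and values in Fin n.
Perm : ℕ → Set
Perm n = Vec (Fin n) n

IsPerm : ∀ {n} → Perm n → Set
IsPerm {n} π = ∀ (x y : Fin n) → lookup π x ≡ lookup π y → x ≡ y

-- swap the entries at 0-indexed positions j and j+1 (identity if out of range)
swapPos : ∀ {A : Set} {m} → ℕ → Vec A m → Vec A m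
swapPos zero (x ∷ y ∷ xs) = y ∷ x ∷ xs
swapPos zero v = v
swapPos (suc j) [] = []
swapPos (suc j) (x ∷ xs) = x ∷ swapPos j xs

-- right multiplication by b_i = (i i+1), 1 ≤ i ≤ n-1 (1-indexed as in the paper):
-- swaps positions i and i+1.
_·b_ : ∀ {n} → Perm n → ℕ → Perm n
π ·b i = swapPos (i ∸ 1) π

_·w_ : ∀ {n} → Perm n → List ℕ → Perm n
π ·w [] = π
π ·w (j ∷ js) = (π ·b j) ·w js

-- words over the alphabet {b_{k-1}, b_k}; they represent exactly ⟨b_{k-1}, b_k⟩
WordIn : ℕ → List ℕ → Set
WordIn k [] = Data.Unit.⊤ where import Data.Unit
WordIn k (j ∷ js) = ((j ≡ k ∸ 1) ⊎ (j ≡ k)) × WordIn k js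

InBlock : ∀ {n} → ℕ → ℕ → Perm n → Perm n → Set
InBlock k i π σ = ∃[ w ] (WordIn k w × ((σ ≡ π ·w w) ⊎ (σ ≡ (π ·w w) ·b i)))

LabAdj : ∀ {n} → ℕ → ℕ → Perm n → Perm n → Set
LabAdj k i x y = (y ≡ x ·b (k ∸ 1)) ⊎ (y ≡ x ·b k) ⊎ (y ≡ x ·b i)

PrismAdj : Fin 2 × Fin 6 → Fin 2 × Fin 6 → Set
PrismAdj (a , s) (b , t) =
  ((a ≡ b) × ((toℕ t ≡ (toℕ s + 1) % 6) ⊎ (toℕ s ≡ (toℕ t + 1) % 6)))
  ⊎ ((a ≢ b) × (s ≡ t))

BlockIsPrism : ∀ {n} → ℕ → ℕ → Perm n → Set
BlockIsPrism {n} k i π =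
  Σ (Fin 2 × Fin 6 → Perm n) λ f →
    (∀ p q → f p ≡ f q → p ≡ q)
    × (∀ p → InBlock k i π (f p))
    × (∀ σ → InBlock k i π σ → ∃[ p ] (f p ≡ σ))
    × (∀ p q → PrismAdj p q ⇔ LabAdj k i (f p) (f q))

PrismCover : ℕ → ℕ → ℕ → Set
PrismCover n k i =
  Σ (List (Perm n)) λ reps →
    (∀ (j : Fin (length reps)) → IsPerm (L.lookup reps j))
    × (∀ (j : Fin (length reps)) → BlockIsPrism k i (L.lookup reps j))
    × (∀ (σ : Perm n) → IsPerm σ →
         Σ (Fin (length reps)) λ j →
           InBlock k i (L.lookup reps j) σ
           × (∀ j' → InBlock k i (L.lookup reps j') σ → j' ≡ j))

-- The group G = ⟨b_{k-1}, b_k⟩ × ⟨b_i⟩ ≅ S₃ × C₂ acts on Sym_n by right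
-- multiplication, the blocks are its orbits, and its Cayley graph for the
-- generators b_{k-1}, b_k, b_i is the 6-prism; since the hypothesis on i makes
-- b_i commute with b_{k-1} and b_k, every block is a copy of that prism.
-- Right multiplication by G only permutes the entries at the five distinct
-- positions k-1, k, k+1, i, i+1, and does so freely, so each block contains
-- exactly one permutation whose entries increase along k-1, k, k+1 and along
-- i, i+1.  These normal forms index the cover.
module Submission where

open import Defs
open import Data.Nat using (ℕ; zero; suc; _≤_; _<_; _∸_; _+_; _%_; z≤n; s≤s) renaming (_≟_ to _≟ℕ_)
open import Data.Nat.Properties using (<-cmp; <-asym; <-trans; <⇒≢; n<1+n; n≤1+n; +-comm; suc-injective)
  renaming (_<?_ to _<?ℕ_)
open import Data.Fin using (Fin; zero; suc; toℕ; fromℕ<) renaming (_≟_ to _≟F_)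
open import Data.Fin.Properties using (toℕ-injective; toℕ-fromℕ<; toℕ<n; all?)
open import Data.Vec using (Vec; []; _∷_; lookup)
open import Data.Vec.Properties using (∷-injective)
open import Data.List using (List; []; _∷_; _∷ʳ_; map; reverse; length; filter; allFin; cartesianProductWith)
import Data.List as List
open import Data.List.Properties using (map-++; unfold-reverse; reverse-map)
open import Data.List.Relation.Unary.Any using (here; index)
open import Data.List.Relation.Unary.Any.Properties using (lookup-index)
import Data.List.Relation.Unary.All as All
open import Data.List.Relation.Unary.All using ([])
open import Data.List.Relation.Unary.Unique.Propositional using (Unique; []; _∷_)
open import Data.List.Relation.Unary.Unique.Propositional.Properties using (allFin⁺; cartesianProductWith⁺; filter⁺)
open import Data.List.Membership.Propositional using (_∈_)
open import Data.List.Membership.Propositional.Properties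
  using (∈-cartesianProductWith⁺; ∈-allFin; ∈-filter⁺; ∈-filter⁻; ∈-lookup)
open import Data.Product using (Σ; _×_; _,_; proj₁; proj₂)
open import Data.Product.Properties using () renaming (≡-dec to ×-≡-dec)
open import Data.Sum using (_⊎_; inj₁; inj₂)
open import Data.Unit using (tt)
open import Data.Empty using (⊥-elim)
open import Function using (_∘_; case_of_)
open import Relation.Nullary using (Dec)
open import Relation.Nullary.Decidable using (toWitness; map′; _×-dec_; _⊎-dec_; _→-dec_; ¬?)
open import Relation.Binary.Definitions using (tri<; tri≈; tri>)
open import Relation.Binary.PropositionalEquality
  using (_≡_; _≢_; refl; sym; trans; cong; subst; subst₂; module ≡-Reasoning)
open import Function.Bundles using (_⇔_; mk⇔)
open import Function.Properties.Equivalence using () renaming (sym to ⇔-sym; trans to ⇔-trans)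

private
  variable
    A : Set
    n m : ℕ

-- Adjacent transpositions of vector entries

swapPos-involutive : ∀ j (v : Vec A m) → swapPos j (swapPos j v) ≡ v
swapPos-involutive zero [] = refl
swapPos-involutive zero (x ∷ []) = refl
swapPos-involutive zero (x ∷ y ∷ v) = refl
swapPos-involutive (suc j) [] = refl
swapPos-involutive (suc j) (x ∷ v) = cong (x ∷_) (swapPos-involutive j v)

swapPos-comm : ∀ a b (v : Vec A m) → a ≢ b → suc a ≢ b → a ≢ suc b →
               swapPos a (swapPos b v) ≡ swapPos b (swapPos a v)
swapPos-comm zero zero v a≢b _ _ = ⊥-elim (a≢b refl)
swapPos-comm zero (suc zero) v _ 1≢1 _ = ⊥-elim (1≢1 refl)
swapPos-comm zero (suc (suc b)) [] _ _ _ = refl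
swapPos-comm zero (suc (suc b)) (x ∷ []) _ _ _ = refl
swapPos-comm zero (suc (suc b)) (x ∷ y ∷ v) _ _ _ = refl
swapPos-comm (suc zero) zero v _ _ 1≢1 = ⊥-elim (1≢1 refl)
swapPos-comm (suc (suc a)) zero [] _ _ _ = refl
swapPos-comm (suc (suc a)) zero (x ∷ []) _ _ _ = refl
swapPos-comm (suc (suc a)) zero (x ∷ y ∷ v) _ _ _ = refl
swapPos-comm (suc a) (suc b) [] _ _ _ = refl
swapPos-comm (suc a) (suc b) (x ∷ v) ne₁ ne₂ ne₃ =
  cong (x ∷_) (swapPos-comm a b v (ne₁ ∘ cong suc) (ne₂ ∘ cong suc) (ne₃ ∘ cong suc))

swapPos-braid : ∀ j (v : Vec A m) → suc (suc j) < m →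
  swapPos j (swapPos (suc j) (swapPos j v)) ≡ swapPos (suc j) (swapPos j (swapPos (suc j) v))
swapPos-braid zero (x ∷ y ∷ z ∷ v) _ = refl
swapPos-braid zero (x ∷ []) (s≤s ())
swapPos-braid zero (x ∷ y ∷ []) (s≤s (s≤s ()))
swapPos-braid (suc j) (x ∷ v) (s≤s j+2<m) = cong (x ∷_) (swapPos-braid j v j+2<m)

-- (s₁ s₂)³ = 1 for s₁ = swapPos j and s₂ = swapPos (suc j), in the form s₂s₁s₂s₁s₂ = s₁.
swapPos-hexagon : ∀ j (v : Vec A m) → suc (suc j) < m →
  swapPos (suc j) (swapPos j (swapPos (suc j) (swapPos j (swapPos (suc j) v)))) ≡ swapPos j v
swapPos-hexagon j v j+2<m = begin
  swapPos (suc j) (swapPos j (swapPos (suc j) (swapPos j (swapPos (suc j) v))))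
    ≡⟨ sym (swapPos-braid j _ j+2<m) ⟩
  swapPos j (swapPos (suc j) (swapPos j (swapPos j (swapPos (suc j) v))))
    ≡⟨ cong (λ u → swapPos j (swapPos (suc j) u)) (swapPos-involutive j _) ⟩
  swapPos j (swapPos (suc j) (swapPos (suc j) v))
    ≡⟨ cong (swapPos j) (swapPos-involutive (suc j) v) ⟩
  swapPos j v ∎
  where open ≡-Reasoning

·w-∷ʳ : ∀ (π : Perm n) ws j → π ·w (ws ∷ʳ j) ≡ (π ·w ws) ·b j
·w-∷ʳ π [] j = refl
·w-∷ʳ π (i ∷ ws) j = ·w-∷ʳ (π ·b i) ws j

·w-reverse : ∀ (π : Perm n) ws → (π ·w ws) ·w reverse ws ≡ π
·w-reverse π [] = refl
·w-reverse π (j ∷ ws) = begin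
  ((π ·b j) ·w ws) ·w reverse (j ∷ ws)   ≡⟨ cong (((π ·b j) ·w ws) ·w_) (unfold-reverse j ws) ⟩
  ((π ·b j) ·w ws) ·w (reverse ws ∷ʳ j)  ≡⟨ ·w-∷ʳ _ (reverse ws) j ⟩
  (((π ·b j) ·w ws) ·w reverse ws) ·b j  ≡⟨ cong (_·b j) (·w-reverse (π ·b j) ws) ⟩
  (π ·b j) ·b j                          ≡⟨ swapPos-involutive (j ∸ 1) π ⟩
  π ∎
  where open ≡-Reasoning

-- Positions out of range read as 0; every lemma below assumes its positions are in range.
entry : ℕ → Vec (Fin n) m → ℕ
entry _ [] = 0
entry zero (x ∷ _) = toℕ x
entry (suc p) (_ ∷ xs) = entry p xs

entry-toℕ : ∀ (v : Vec (Fin n) m) x → entry (toℕ x) v ≡ toℕ (lookup v x)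
entry-toℕ (_ ∷ _) zero = refl
entry-toℕ (_ ∷ v) (suc x) = entry-toℕ v x

swapIndex : ℕ → ℕ → ℕ
swapIndex zero zero = 1
swapIndex zero (suc zero) = 0
swapIndex zero p@(suc (suc _)) = p
swapIndex (suc j) zero = zero
swapIndex (suc j) (suc p) = suc (swapIndex j p)

swapIndex-at : ∀ j → swapIndex j j ≡ suc j
swapIndex-at zero = refl
swapIndex-at (suc j) = cong suc (swapIndex-at j)

swapIndex-next : ∀ j → swapIndex j (suc j) ≡ j
swapIndex-next zero = refl
swapIndex-next (suc j) = cong suc (swapIndex-next j)

swapIndex-other : ∀ j p → p ≢ j → p ≢ suc j → swapIndex j p ≡ p
swapIndex-other zero zero p≢j _ = ⊥-elim (p≢j refl)
swapIndex-other zero (suc zero) _ p≢1 = ⊥-elim (p≢1 refl)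
swapIndex-other zero (suc (suc p)) _ _ = refl
swapIndex-other (suc j) zero _ _ = refl
swapIndex-other (suc j) (suc p) ne₁ ne₂ =
  cong suc (swapIndex-other j p (ne₁ ∘ cong suc) (ne₂ ∘ cong suc))

swapIndex-involutive : ∀ j p → swapIndex j (swapIndex j p) ≡ p
swapIndex-involutive zero zero = refl
swapIndex-involutive zero (suc zero) = refl
swapIndex-involutive zero (suc (suc p)) = refl
swapIndex-involutive (suc j) zero = refl
swapIndex-involutive (suc j) (suc p) = cong suc (swapIndex-involutive j p)

swapIndex-< : ∀ j p → suc j < m → p < m → swapIndex j p < m
swapIndex-< zero zero j+1<m _ = j+1<m
swapIndex-< zero (suc zero) _ (s≤s _) = s≤s z≤n
swapIndex-< zero (suc (suc p)) _ p<m = p<m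
swapIndex-< (suc j) zero _ (s≤s _) = s≤s z≤n
swapIndex-< (suc j) (suc p) (s≤s j+1<m) (s≤s p<m) = s≤s (swapIndex-< j p j+1<m p<m)

entry-swapPos : ∀ j p (v : Vec (Fin n) m) → suc j < m → entry p (swapPos j v) ≡ entry (swapIndex j p) v
entry-swapPos zero zero (x ∷ y ∷ v) _ = refl
entry-swapPos zero (suc zero) (x ∷ y ∷ v) _ = refl
entry-swapPos zero (suc (suc p)) (x ∷ y ∷ v) _ = refl
entry-swapPos zero p (x ∷ []) (s≤s ())
entry-swapPos (suc j) zero (x ∷ v) _ = refl
entry-swapPos (suc j) (suc p) (x ∷ v) (s≤s j+1<m) = entry-swapPos j p v j+1<m

DistinctEntries : Vec (Fin n) m → Set
DistinctEntries {m = m} v = ∀ p q → p < m → q < m → entry p v ≡ entry q v → p ≡ q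

swapPos-distinct : ∀ j (v : Vec (Fin n) m) → suc j < m → DistinctEntries v → DistinctEntries (swapPos j v)
swapPos-distinct j v j+1<m distinct p q p<m q<m e = begin
  p                             ≡⟨ sym (swapIndex-involutive j p) ⟩
  swapIndex j (swapIndex j p)   ≡⟨ cong (swapIndex j) swapped ⟩
  swapIndex j (swapIndex j q)   ≡⟨ swapIndex-involutive j q ⟩
  q ∎
  where
  open ≡-Reasoning
  swapped : swapIndex j p ≡ swapIndex j q
  swapped = distinct _ _ (swapIndex-< j p j+1<m p<m) (swapIndex-< j q j+1<m q<m)
    (trans (sym (entry-swapPos j p v j+1<m)) (trans e (entry-swapPos j q v j+1<m)))

IsPerm⇒DistinctEntries : ∀ (π : Perm n) → IsPerm π → DistinctEntries π
IsPerm⇒DistinctEntries π injective p q p<n q<n e = begin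
  p                   ≡⟨ sym (toℕ-fromℕ< p<n) ⟩
  toℕ (fromℕ< p<n)    ≡⟨ cong toℕ (injective _ _ (toℕ-injective lookups)) ⟩
  toℕ (fromℕ< q<n)    ≡⟨ toℕ-fromℕ< q<n ⟩
  q ∎
  where
  open ≡-Reasoning
  entry-fromℕ< : ∀ {r} (r<n : r < _) → entry r π ≡ toℕ (lookup π (fromℕ< r<n))
  entry-fromℕ< r<n = trans (cong (λ r → entry r π) (sym (toℕ-fromℕ< r<n))) (entry-toℕ π _)
  lookups : toℕ (lookup π (fromℕ< p<n)) ≡ toℕ (lookup π (fromℕ< q<n))
  lookups = trans (sym (entry-fromℕ< p<n)) (trans e (entry-fromℕ< q<n))

DistinctEntries⇒IsPerm : ∀ (π : Perm n) → DistinctEntries π → IsPerm π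
DistinctEntries⇒IsPerm π distinct x y e = toℕ-injective (distinct _ _ (toℕ<n x) (toℕ<n y)
  (trans (entry-toℕ π x) (trans (cong toℕ e) (sym (entry-toℕ π y)))))

allVecs : ∀ m → List (Vec (Fin n) m)
allVecs zero = [] ∷ []
allVecs {n} (suc m) = cartesianProductWith _∷_ (allFin n) (allVecs m)

allVecs-unique : ∀ m → Unique (allVecs {n} m)
allVecs-unique zero = [] ∷ []
allVecs-unique {n} (suc m) = cartesianProductWith⁺ _∷_ ∷-injective (allFin⁺ n) (allVecs-unique m)

∈-allVecs : ∀ (v : Vec (Fin n) m) → v ∈ allVecs m
∈-allVecs [] = here refl
∈-allVecs (x ∷ v) = ∈-cartesianProductWith⁺ _∷_ (∈-allFin x) (∈-allVecs v)

Unique⇒lookup-injective : ∀ {xs : List A} → Unique xs → ∀ i j → List.lookup xs i ≡ List.lookup xs j → i ≡ j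
Unique⇒lookup-injective (_ ∷ _) zero zero _ = refl
Unique⇒lookup-injective (x∉ ∷ _) zero (suc j) e = ⊥-elim (All.lookup x∉ (∈-lookup j) e)
Unique⇒lookup-injective (x∉ ∷ _) (suc i) zero e = ⊥-elim (All.lookup x∉ (∈-lookup i) (sym e))
Unique⇒lookup-injective (_ ∷ u) (suc i) (suc j) e = cong suc (Unique⇒lookup-injective u i j e)

-- The 6-prism as a Cayley graph of S₃ × C₂

data Gen : Set where
  bₖ₋₁ bₖ bᵢ : Gen

PrismVertex : Set
PrismVertex = Fin 2 × Fin 6

pattern f0 = zero
pattern f1 = suc zero
pattern f2 = suc (suc zero)
pattern f3 = suc (suc (suc zero))
pattern f4 = suc (suc (suc (suc zero)))
pattern f5 = suc (suc (suc (suc (suc zero))))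

-- Vertex (a , s) is the group element given by the first s letters of
-- bₖ bₖ₋₁ bₖ bₖ₋₁ bₖ, followed by bᵢ when a = 1.
hexWord : Fin 6 → List Gen
hexWord f0 = []
hexWord f1 = bₖ ∷ []
hexWord f2 = bₖ ∷ bₖ₋₁ ∷ []
hexWord f3 = bₖ ∷ bₖ₋₁ ∷ bₖ ∷ []
hexWord f4 = bₖ ∷ bₖ₋₁ ∷ bₖ ∷ bₖ₋₁ ∷ []
hexWord f5 = bₖ ∷ bₖ₋₁ ∷ bₖ ∷ bₖ₋₁ ∷ bₖ ∷ []

word : PrismVertex → List Gen
word (f0 , s) = hexWord s
word (f1 , s) = hexWord s ∷ʳ bᵢ

hexₖ hexₖ₋₁ : Fin 6 → Fin 6
hexₖ f0 = f1
hexₖ f1 = f0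
hexₖ f2 = f3
hexₖ f3 = f2
hexₖ f4 = f5
hexₖ f5 = f4
hexₖ₋₁ f0 = f5
hexₖ₋₁ f1 = f2
hexₖ₋₁ f2 = f1
hexₖ₋₁ f3 = f4
hexₖ₋₁ f4 = f3
hexₖ₋₁ f5 = f0

flipLayer : Fin 2 → Fin 2
flipLayer f0 = f1
flipLayer f1 = f0

_·_ : PrismVertex → Gen → PrismVertex
(a , s) · bₖ₋₁ = a , hexₖ₋₁ s
(a , s) · bₖ = a , hexₖ s
(a , s) · bᵢ = flipLayer a , s

CayleyAdj : PrismVertex → PrismVertex → Set
CayleyAdj p q = (q ≡ p · bₖ₋₁) ⊎ (q ≡ p · bₖ) ⊎ (q ≡ p · bᵢ)

_≟V_ : (p q : PrismVertex) → Dec (p ≡ q)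
_≟V_ = ×-≡-dec _≟F_ _≟F_

∀-vertex? : {P : PrismVertex → Set} → (∀ p → Dec (P p)) → Dec (∀ p → P p)
∀-vertex? P? = map′ (λ h (a , s) → h a s) (λ h a s → h (a , s)) (all? λ a → all? λ s → P? (a , s))

cayleyAdj? : ∀ p q → Dec (CayleyAdj p q)
cayleyAdj? p q = (q ≟V (p · bₖ₋₁)) ⊎-dec ((q ≟V (p · bₖ)) ⊎-dec (q ≟V (p · bᵢ)))

prismAdj? : ∀ p q → Dec (PrismAdj p q)
prismAdj? (a , s) (b , t) =
  ((a ≟F b) ×-dec ((toℕ t ≟ℕ (toℕ s + 1) % 6) ⊎-dec (toℕ s ≟ℕ (toℕ t + 1) % 6)))
  ⊎-dec (¬? (a ≟F b) ×-dec (s ≟F t))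

cayleyAdj⇔prismAdj : ∀ p q → CayleyAdj p q ⇔ PrismAdj p q
cayleyAdj⇔prismAdj p q = mk⇔ (cayley⇒prism p q) (prism⇒cayley p q)
  where
  cayley⇒prism : ∀ p q → CayleyAdj p q → PrismAdj p q
  cayley⇒prism = toWitness {a? = ∀-vertex? λ p → ∀-vertex? λ q → cayleyAdj? p q →-dec prismAdj? p q} tt
  prism⇒cayley : ∀ p q → PrismAdj p q → CayleyAdj p q
  prism⇒cayley = toWitness {a? = ∀-vertex? λ p → ∀-vertex? λ q → prismAdj? p q →-dec cayleyAdj? p q} tt

-- The action on the five tracked positions

-- Slots 0, 1, 2 stand for the positions k-1, k, k+1 and slots 3, 4 for i, i+1.
act : Gen → Fin 5 → Fin 5
act bₖ₋₁ f0 = f1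
act bₖ₋₁ f1 = f0
act bₖ₋₁ t = t
act bₖ f1 = f2
act bₖ f2 = f1
act bₖ t = t
act bᵢ f3 = f4
act bᵢ f4 = f3
act bᵢ t = t

actWord : List Gen → Fin 5 → Fin 5
actWord [] t = t
actWord (g ∷ gs) t = act g (actWord gs t)

shuffle : PrismVertex → Fin 5 → Fin 5
shuffle p = actWord (word p)

shuffle-injective : ∀ p q → (∀ t → shuffle p t ≡ shuffle q t) → p ≡ q
shuffle-injective = toWitness {a? = ∀-vertex? λ p → ∀-vertex? λ q →
  (all? λ t → shuffle p t ≟F shuffle q t) →-dec (p ≟V q)} tt

Ordered : (Fin 5 → ℕ) → Set
Ordered y = y f0 < y f1 × y f1 < y f2 × y f3 < y f4

Ordered-resp : ∀ {y z} → (∀ t → y t ≡ z t) → Ordered y → Ordered z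
Ordered-resp y≗z (0<1 , 1<2 , 3<4) =
  subst₂ _<_ (y≗z f0) (y≗z f1) 0<1 , subst₂ _<_ (y≗z f1) (y≗z f2) 1<2 , subst₂ _<_ (y≗z f3) (y≗z f4) 3<4

ordered-unique : ∀ y p → Ordered y → Ordered (λ t → y (shuffle p t)) → p ≡ (f0 , f0)
ordered-unique y (f0 , f0) _ _ = refl
ordered-unique y (f0 , f1) (_ , 1<2 , _) (_ , 2<1 , _) = ⊥-elim (<-asym 1<2 2<1)
ordered-unique y (f0 , f2) (0<1 , 1<2 , _) (2<0 , _ , _) = ⊥-elim (<-asym (<-trans 0<1 1<2) 2<0)
ordered-unique y (f0 , f3) (_ , 1<2 , _) (2<1 , _ , _) = ⊥-elim (<-asym 1<2 2<1)
ordered-unique y (f0 , f4) (0<1 , 1<2 , _) (_ , 2<0 , _) = ⊥-elim (<-asym (<-trans 0<1 1<2) 2<0)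
ordered-unique y (f0 , f5) (0<1 , _ , _) (1<0 , _ , _) = ⊥-elim (<-asym 0<1 1<0)
ordered-unique y (f1 , f0) (_ , _ , 3<4) (_ , _ , 4<3) = ⊥-elim (<-asym 3<4 4<3)
ordered-unique y (f1 , f1) (_ , _ , 3<4) (_ , _ , 4<3) = ⊥-elim (<-asym 3<4 4<3)
ordered-unique y (f1 , f2) (_ , _ , 3<4) (_ , _ , 4<3) = ⊥-elim (<-asym 3<4 4<3)
ordered-unique y (f1 , f3) (_ , _ , 3<4) (_ , _ , 4<3) = ⊥-elim (<-asym 3<4 4<3)
ordered-unique y (f1 , f4) (_ , _ , 3<4) (_ , _ , 4<3) = ⊥-elim (<-asym 3<4 4<3)
ordered-unique y (f1 , f5) (_ , _ , 3<4) (_ , _ , 4<3) = ⊥-elim (<-asym 3<4 4<3)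

Distinct : (Fin 5 → ℕ) → Set
Distinct y = ∀ t u → y t ≡ y u → t ≡ u

ordering-vertex : ∀ y → Distinct y → Σ PrismVertex λ p → Ordered (λ t → y (shuffle p t))
ordering-vertex y distinct
  with <-cmp (y f0) (y f1) | <-cmp (y f1) (y f2) | <-cmp (y f0) (y f2) | <-cmp (y f3) (y f4)
... | tri≈ _ e _ | _ | _ | _ = case distinct f0 f1 e of λ ()
... | _ | tri≈ _ e _ | _ | _ = case distinct f1 f2 e of λ ()
... | _ | _ | tri≈ _ e _ | _ = case distinct f0 f2 e of λ ()
... | _ | _ | _ | tri≈ _ e _ = case distinct f3 f4 e of λ ()
... | tri< 0<1 _ _ | tri< 1<2 _ _ | _           | tri< 3<4 _ _ = (f0 , f0) , 0<1 , 1<2 , 3<4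
... | tri< 0<1 _ _ | tri< 1<2 _ _ | _           | tri> _ _ 4<3 = (f1 , f0) , 0<1 , 1<2 , 4<3
... | tri< _ _ _   | tri> _ _ 2<1 | tri< 0<2 _ _ | tri< 3<4 _ _ = (f0 , f1) , 0<2 , 2<1 , 3<4
... | tri< _ _ _   | tri> _ _ 2<1 | tri< 0<2 _ _ | tri> _ _ 4<3 = (f1 , f1) , 0<2 , 2<1 , 4<3
... | tri< 0<1 _ _ | tri> _ _ _   | tri> _ _ 2<0 | tri< 3<4 _ _ = (f0 , f2) , 2<0 , 0<1 , 3<4
... | tri< 0<1 _ _ | tri> _ _ _   | tri> _ _ 2<0 | tri> _ _ 4<3 = (f1 , f2) , 2<0 , 0<1 , 4<3
... | tri> _ _ 1<0 | tri> _ _ 2<1 | _           | tri< 3<4 _ _ = (f0 , f3) , 2<1 , 1<0 , 3<4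
... | tri> _ _ 1<0 | tri> _ _ 2<1 | _           | tri> _ _ 4<3 = (f1 , f3) , 2<1 , 1<0 , 4<3
... | tri> _ _ _   | tri< 1<2 _ _ | tri> _ _ 2<0 | tri< 3<4 _ _ = (f0 , f4) , 1<2 , 2<0 , 3<4
... | tri> _ _ _   | tri< 1<2 _ _ | tri> _ _ 2<0 | tri> _ _ 4<3 = (f1 , f4) , 1<2 , 2<0 , 4<3
... | tri> _ _ 1<0 | tri< _ _ _   | tri< 0<2 _ _ | tri< 3<4 _ _ = (f0 , f5) , 1<0 , 0<2 , 3<4
... | tri> _ _ 1<0 | tri< _ _ _   | tri< 0<2 _ _ | tri> _ _ 4<3 = (f1 , f5) , 1<0 , 0<2 , 4<3

-- Blocks in the Bubble-sort graph

-- Here k = m + 2 and i = j + 1, so b_{k-1}, b_k and b_i swap the 0-indexed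
-- positions m, m+1 (resp. m+1, m+2, resp. j, j+1).
module Blocks (n m j : ℕ) (m+2<n : suc (suc m) < n) (j+1<n : suc j < n)
              (j≢m : j ≢ m) (j≢m+1 : j ≢ suc m) (j≢m+2 : j ≢ suc (suc m)) (j+1≢m : suc j ≢ m) where

  k i : ℕ
  k = suc (suc m)
  i = suc j

  m+1<n : suc m < n
  m+1<n = <-trans (n<1+n (suc m)) m+2<n

  lab : Gen → ℕ
  lab bₖ₋₁ = suc m
  lab bₖ = k
  lab bᵢ = i

  pos : Fin 5 → ℕ
  pos f0 = m
  pos f1 = suc m
  pos f2 = suc (suc m)
  pos f3 = j
  pos f4 = suc j

  pos-< : ∀ t → pos t < n
  pos-< f0 = <-trans (n<1+n m) m+1<n
  pos-< f1 = m+1<n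
  pos-< f2 = m+2<n
  pos-< f3 = <-trans (n<1+n j) j+1<n
  pos-< f4 = j+1<n

  x≢x+1 : ∀ x → x ≢ suc x
  x≢x+1 x = <⇒≢ (n<1+n x)

  x≢x+2 : ∀ x → x ≢ suc (suc x)
  x≢x+2 x = <⇒≢ (s≤s (n≤1+n x))

  pos-injective : ∀ t u → pos t ≡ pos u → t ≡ u
  pos-injective f0 f0 _ = refl
  pos-injective f0 f1 e = ⊥-elim (x≢x+1 m e)
  pos-injective f0 f2 e = ⊥-elim (x≢x+2 m e)
  pos-injective f0 f3 e = ⊥-elim (j≢m (sym e))
  pos-injective f0 f4 e = ⊥-elim (j+1≢m (sym e))
  pos-injective f1 f0 e = ⊥-elim (x≢x+1 m (sym e))
  pos-injective f1 f1 _ = refl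
  pos-injective f1 f2 e = ⊥-elim (x≢x+1 (suc m) e)
  pos-injective f1 f3 e = ⊥-elim (j≢m+1 (sym e))
  pos-injective f1 f4 e = ⊥-elim (j≢m (suc-injective (sym e)))
  pos-injective f2 f0 e = ⊥-elim (x≢x+2 m (sym e))
  pos-injective f2 f1 e = ⊥-elim (x≢x+1 (suc m) (sym e))
  pos-injective f2 f2 _ = refl
  pos-injective f2 f3 e = ⊥-elim (j≢m+2 (sym e))
  pos-injective f2 f4 e = ⊥-elim (j≢m+1 (suc-injective (sym e)))
  pos-injective f3 f0 e = ⊥-elim (j≢m e)
  pos-injective f3 f1 e = ⊥-elim (j≢m+1 e)
  pos-injective f3 f2 e = ⊥-elim (j≢m+2 e)
  pos-injective f3 f3 _ = refl
  pos-injective f3 f4 e = ⊥-elim (x≢x+1 j e)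
  pos-injective f4 f0 e = ⊥-elim (j+1≢m e)
  pos-injective f4 f1 e = ⊥-elim (j≢m (suc-injective e))
  pos-injective f4 f2 e = ⊥-elim (j≢m+1 (suc-injective e))
  pos-injective f4 f3 e = ⊥-elim (x≢x+1 j (sym e))
  pos-injective f4 f4 _ = refl

  swapIndex-pos : ∀ g t → swapIndex (lab g ∸ 1) (pos t) ≡ pos (act g t)
  swapIndex-pos bₖ₋₁ f0 = swapIndex-at m
  swapIndex-pos bₖ₋₁ f1 = swapIndex-next m
  swapIndex-pos bₖ₋₁ f2 = swapIndex-other m _ (λ e → x≢x+2 m (sym e)) (λ e → x≢x+1 (suc m) (sym e))
  swapIndex-pos bₖ₋₁ f3 = swapIndex-other m j j≢m j≢m+1
  swapIndex-pos bₖ₋₁ f4 = swapIndex-other m (suc j) j+1≢m (λ e → j≢m (suc-injective e))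
  swapIndex-pos bₖ f0 = swapIndex-other (suc m) m (x≢x+1 m) (x≢x+2 m)
  swapIndex-pos bₖ f1 = swapIndex-at (suc m)
  swapIndex-pos bₖ f2 = swapIndex-next (suc m)
  swapIndex-pos bₖ f3 = swapIndex-other (suc m) j j≢m+1 j≢m+2
  swapIndex-pos bₖ f4 = swapIndex-other (suc m) (suc j) (λ e → j≢m (suc-injective e)) (λ e → j≢m+1 (suc-injective e))
  swapIndex-pos bᵢ f0 = swapIndex-other j m (λ e → j≢m (sym e)) (λ e → j+1≢m (sym e))
  swapIndex-pos bᵢ f1 = swapIndex-other j (suc m) (λ e → j≢m+1 (sym e)) (λ e → j≢m (suc-injective (sym e)))
  swapIndex-pos bᵢ f2 = swapIndex-other j _ (λ e → j≢m+2 (sym e)) (λ e → j≢m+1 (suc-injective (sym e)))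
  swapIndex-pos bᵢ f3 = swapIndex-at j
  swapIndex-pos bᵢ f4 = swapIndex-next j

  lab-< : ∀ g → suc (lab g ∸ 1) < n
  lab-< bₖ₋₁ = m+1<n
  lab-< bₖ = m+2<n
  lab-< bᵢ = j+1<n

  entry-·b : ∀ (π : Perm n) g t → entry (pos t) (π ·b lab g) ≡ entry (pos (act g t)) π
  entry-·b π g t = trans (entry-swapPos (lab g ∸ 1) (pos t) π (lab-< g)) (cong (λ p → entry p π) (swapIndex-pos g t))

  entry-·w : ∀ (π : Perm n) gs t → entry (pos t) (π ·w map lab gs) ≡ entry (pos (actWord gs t)) π
  entry-·w π [] t = refl
  entry-·w π (g ∷ gs) t = trans (entry-·w (π ·b lab g) gs t) (entry-·b π g (actWord gs t))

  block : Perm n → PrismVertex → Perm n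
  block π p = π ·w map lab (word p)

  entry-block : ∀ π p t → entry (pos t) (block π p) ≡ entry (pos (shuffle p t)) π
  entry-block π p = entry-·w π (word p)

  block-layer₁ : ∀ π s → block π (f1 , s) ≡ block π (f0 , s) ·b i
  block-layer₁ π s = begin
    π ·w map lab (hexWord s ∷ʳ bᵢ)          ≡⟨ cong (π ·w_) (map-++ lab (hexWord s) (bᵢ ∷ [])) ⟩
    π ·w (map lab (hexWord s) ∷ʳ i)          ≡⟨ ·w-∷ʳ π (map lab (hexWord s)) i ⟩
    (π ·w map lab (hexWord s)) ·b i ∎
    where open ≡-Reasoning

  hexagon : ∀ (π : Perm n) → π ·w map lab (hexWord f5) ≡ π ·b lab bₖ₋₁
  hexagon π = swapPos-hexagon m π m+2<n

  block-·bₖ : ∀ π s → block π (f0 , s) ·b k ≡ block π (f0 , hexₖ s)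
  block-·bₖ π f0 = refl
  block-·bₖ π f1 = swapPos-involutive (suc m) π
  block-·bₖ π f2 = refl
  block-·bₖ π f3 = swapPos-involutive (suc m) _
  block-·bₖ π f4 = refl
  block-·bₖ π f5 = swapPos-involutive (suc m) _

  block-·bₖ₋₁ : ∀ π s → block π (f0 , s) ·b suc m ≡ block π (f0 , hexₖ₋₁ s)
  block-·bₖ₋₁ π f0 = sym (hexagon π)
  block-·bₖ₋₁ π f1 = refl
  block-·bₖ₋₁ π f2 = swapPos-involutive m _
  block-·bₖ₋₁ π f3 = refl
  block-·bₖ₋₁ π f4 = swapPos-involutive m _
  block-·bₖ₋₁ π f5 = trans (cong (_·b suc m) (hexagon π)) (swapPos-involutive m π)

  ·bᵢ-comm : ∀ (π : Perm n) g → g ≢ bᵢ → (π ·b i) ·b lab g ≡ (π ·b lab g) ·b i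
  ·bᵢ-comm π bₖ₋₁ _ = swapPos-comm m j π (λ e → j≢m (sym e)) (λ e → j≢m+1 (sym e)) (λ e → j+1≢m (sym e))
  ·bᵢ-comm π bₖ _ = swapPos-comm (suc m) j π (λ e → j≢m+1 (sym e)) (λ e → j≢m+2 (sym e))
                                           (λ e → j≢m (suc-injective (sym e)))
  ·bᵢ-comm π bᵢ bᵢ≢bᵢ = ⊥-elim (bᵢ≢bᵢ refl)

  block-·b : ∀ π p g → block π p ·b lab g ≡ block π (p · g)
  block-·b π (f0 , s) bₖ₋₁ = block-·bₖ₋₁ π s
  block-·b π (f0 , s) bₖ = block-·bₖ π s
  block-·b π (f0 , s) bᵢ = sym (block-layer₁ π s)
  block-·b π (f1 , s) g = begin
    block π (f1 , s) ·b lab g        ≡⟨ cong (_·b lab g) (block-layer₁ π s) ⟩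
    (block π (f0 , s) ·b i) ·b lab g ≡⟨ layer₁-step g ⟩
    block π ((f1 , s) · g) ∎
    where
    open ≡-Reasoning
    layer₁-step : ∀ g → (block π (f0 , s) ·b i) ·b lab g ≡ block π ((f1 , s) · g)
    layer₁-step bᵢ = swapPos-involutive j _
    layer₁-step bₖ₋₁ = trans (·bᵢ-comm _ bₖ₋₁ (λ ()))
      (trans (cong (_·b i) (block-·bₖ₋₁ π s)) (sym (block-layer₁ π (hexₖ₋₁ s))))
    layer₁-step bₖ = trans (·bᵢ-comm _ bₖ (λ ()))
      (trans (cong (_·b i) (block-·bₖ π s)) (sym (block-layer₁ π (hexₖ s))))

  block-·w : ∀ π p gs → Σ PrismVertex λ q → block π p ·w map lab gs ≡ block π q
  block-·w π p [] = p , refl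
  block-·w π p (g ∷ gs) with block-·w π (p · g) gs
  ... | q , e = q , trans (cong (_·w map lab gs) (block-·b π p g)) e

  block-block : ∀ π p q → Σ PrismVertex λ r → block (block π p) q ≡ block π r
  block-block π p q = block-·w π p (word q)

  block-inverse : ∀ π p → Σ PrismVertex λ q → block (block π p) q ≡ π
  block-inverse π p with block-·w (block π p) (f0 , f0) (reverse (word p))
  ... | q , e = q , (begin
    block (block π p) q                             ≡⟨ sym e ⟩
    block π p ·w map lab (reverse (word p))          ≡⟨ cong (block π p ·w_) (reverse-map lab (word p)) ⟩
    block π p ·w reverse (map lab (word p))          ≡⟨ ·w-reverse π (map lab (word p)) ⟩
    π ∎)
    where open ≡-Reasoning

  WordIn⇒labels : ∀ w → WordIn k w → Σ (List Gen) λ gs → w ≡ map lab gs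
  WordIn⇒labels [] _ = [] , refl
  WordIn⇒labels (_ ∷ w) (inj₁ refl , w∈) with WordIn⇒labels w w∈
  ... | gs , e = bₖ₋₁ ∷ gs , cong (suc m ∷_) e
  WordIn⇒labels (_ ∷ w) (inj₂ refl , w∈) with WordIn⇒labels w w∈
  ... | gs , e = bₖ ∷ gs , cong (k ∷_) e

  hexWord-WordIn : ∀ s → WordIn k (map lab (hexWord s))
  hexWord-WordIn f0 = tt
  hexWord-WordIn f1 = inj₂ refl , tt
  hexWord-WordIn f2 = inj₂ refl , inj₁ refl , tt
  hexWord-WordIn f3 = inj₂ refl , inj₁ refl , inj₂ refl , tt
  hexWord-WordIn f4 = inj₂ refl , inj₁ refl , inj₂ refl , inj₁ refl , tt
  hexWord-WordIn f5 = inj₂ refl , inj₁ refl , inj₂ refl , inj₁ refl , inj₂ refl , tt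

  block-InBlock : ∀ π p → InBlock k i π (block π p)
  block-InBlock π (f0 , s) = map lab (hexWord s) , hexWord-WordIn s , inj₁ refl
  block-InBlock π (f1 , s) = map lab (hexWord s) , hexWord-WordIn s , inj₂ (block-layer₁ π s)

  InBlock⇒block : ∀ π σ → InBlock k i π σ → Σ PrismVertex λ p → block π p ≡ σ
  InBlock⇒block π σ (w , w∈ , σ≡) with WordIn⇒labels w w∈
  ... | gs , refl with block-·w π (f0 , f0) gs | σ≡
  ...   | q , e | inj₁ σ≡πw = q , trans (sym e) (sym σ≡πw)
  ...   | q , e | inj₂ σ≡πwbᵢ = q · bᵢ , (begin
    block π (q · bᵢ)               ≡⟨ sym (block-·b π q bᵢ) ⟩
    block π q ·b i                 ≡⟨ cong (_·b i) (sym e) ⟩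
    (π ·w map lab gs) ·b i         ≡⟨ sym σ≡πwbᵢ ⟩
    σ ∎)
    where open ≡-Reasoning

  InBlock-block : ∀ π p → InBlock k i (block π p) π
  InBlock-block π p with block-inverse π p
  ... | q , e = subst (InBlock k i (block π p)) e (block-InBlock (block π p) q)

  block-injective : ∀ π → DistinctEntries π → ∀ p q → block π p ≡ block π q → p ≡ q
  block-injective π distinct p q e = shuffle-injective p q λ t →
    pos-injective _ _ (distinct _ _ (pos-< _) (pos-< _)
      (trans (sym (entry-block π p t)) (trans (cong (entry (pos t)) e) (entry-block π q t))))

  ·w-distinct : ∀ π gs → DistinctEntries π → DistinctEntries (π ·w map lab gs)
  ·w-distinct π [] distinct = distinct
  ·w-distinct π (g ∷ gs) distinct = ·w-distinct (π ·b lab g) gs (swapPos-distinct (lab g ∸ 1) π (lab-< g) distinct)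

  block-isPerm : ∀ π p → IsPerm π → IsPerm (block π p)
  block-isPerm π p perm = DistinctEntries⇒IsPerm (block π p) (·w-distinct π (word p) (IsPerm⇒DistinctEntries π perm))

  block-adjacency : ∀ π → DistinctEntries π → ∀ p q → CayleyAdj p q ⇔ LabAdj k i (block π p) (block π q)
  block-adjacency π distinct p q = mk⇔ to from
    where
    via : ∀ g → q ≡ p · g → block π q ≡ block π p ·b lab g
    via g refl = sym (block-·b π p g)
    back : ∀ g → block π q ≡ block π p ·b lab g → q ≡ p · g
    back g e = block-injective π distinct q (p · g) (trans e (block-·b π p g))
    to : CayleyAdj p q → LabAdj k i (block π p) (block π q)
    to (inj₁ e) = inj₁ (via bₖ₋₁ e)
    to (inj₂ (inj₁ e)) = inj₂ (inj₁ (via bₖ e))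
    to (inj₂ (inj₂ e)) = inj₂ (inj₂ (via bᵢ e))
    from : LabAdj k i (block π p) (block π q) → CayleyAdj p q
    from (inj₁ e) = inj₁ (back bₖ₋₁ e)
    from (inj₂ (inj₁ e)) = inj₂ (inj₁ (back bₖ e))
    from (inj₂ (inj₂ e)) = inj₂ (inj₂ (back bᵢ e))

  block-isPrism : ∀ π → IsPerm π → BlockIsPrism k i π
  block-isPrism π perm =
    block π , block-injective π distinct , block-InBlock π , InBlock⇒block π ,
    λ p q → ⇔-trans (⇔-sym (cayleyAdj⇔prismAdj p q)) (block-adjacency π distinct p q)
    where distinct = IsPerm⇒DistinctEntries π perm

  Normal : Perm n → Set
  Normal π = Ordered (λ t → entry (pos t) π)

  normal? : ∀ π → Dec (Normal π)
  normal? π = (entry m π <?ℕ entry (suc m) π) ×-dec (entry (suc m) π <?ℕ entry (suc (suc m)) π)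
              ×-dec (entry j π <?ℕ entry (suc j) π)

  normal-unique : ∀ π p → Normal π → Normal (block π p) → block π p ≡ π
  normal-unique π p normal normal′
    with ordered-unique (λ t → entry (pos t) π) p normal (Ordered-resp (entry-block π p) normal′)
  ... | refl = refl

  tracked-distinct : ∀ π → IsPerm π → Distinct (λ t → entry (pos t) π)
  tracked-distinct π perm t u e = pos-injective t u (IsPerm⇒DistinctEntries π perm _ _ (pos-< t) (pos-< u) e)

  normalise : ∀ π → IsPerm π → Σ PrismVertex λ p → Normal (block π p)
  normalise π perm with ordering-vertex (λ t → entry (pos t) π) (tracked-distinct π perm)
  ... | p , ordered = p , Ordered-resp (λ t → sym (entry-block π p t)) ordered

  isPerm? : ∀ (π : Perm n) → Dec (IsPerm π)
  isPerm? π = all? λ x → all? λ y → (lookup π x ≟F lookup π y) →-dec (x ≟F y)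

  Representative : Perm n → Set
  Representative π = IsPerm π × Normal π

  representative? : ∀ π → Dec (Representative π)
  representative? π = isPerm? π ×-dec normal? π

  representatives : List (Perm n)
  representatives = filter representative? (allVecs n)

  rep : Fin (length representatives) → Perm n
  rep = List.lookup representatives

  rep-representative : ∀ r → Representative (rep r)
  rep-representative r = proj₂ (∈-filter⁻ representative? {xs = allVecs n} (∈-lookup r))

  rep-injective : ∀ r r′ → rep r ≡ rep r′ → r ≡ r′
  rep-injective = Unique⇒lookup-injective (filter⁺ representative? (allVecs-unique n))

  rep-unique : ∀ σ r r′ → InBlock k i (rep r) σ → InBlock k i (rep r′) σ → r′ ≡ r
  rep-unique σ r r′ σ∈r σ∈r′ with InBlock⇒block (rep r) σ σ∈r | InBlock⇒block (rep r′) σ σ∈r′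
  ... | p , refl | p′ , e′ with block-inverse (rep r′) p′
  ...   | q′ , e″ with block-block (rep r) p q′
  ...     | x , e =
    rep-injective r′ r (trans r′≡x (normal-unique (rep r) x (normal r) (subst Normal r′≡x (normal r′))))
    where
    normal : ∀ r → Normal (rep r)
    normal r = proj₂ (rep-representative r)
    open ≡-Reasoning
    r′≡x : rep r′ ≡ block (rep r) x
    r′≡x = begin
      rep r′                        ≡⟨ sym e″ ⟩
      block (block (rep r′) p′) q′  ≡⟨ cong (λ σ → block σ q′) e′ ⟩
      block (block (rep r) p) q′    ≡⟨ e ⟩
      block (rep r) x ∎

  prismCover : PrismCover n k i
  prismCover = representatives , (λ r → proj₁ (rep-representative r)) ,
    (λ r → block-isPrism (rep r) (proj₁ (rep-representative r))) , covers
    where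
    covers : ∀ σ → IsPerm σ → Σ (Fin (length representatives)) λ r →
               InBlock k i (rep r) σ × (∀ r′ → InBlock k i (rep r′) σ → r′ ≡ r)
    covers σ perm = r , σ∈r , λ r′ σ∈r′ → rep-unique σ r r′ σ∈r σ∈r′
      where
      p = proj₁ (normalise σ perm)
      ρ∈ : block σ p ∈ representatives
      ρ∈ = ∈-filter⁺ representative? (∈-allVecs (block σ p)) (block-isPerm σ p perm , proj₂ (normalise σ perm))
      r = index ρ∈
      σ∈r : InBlock k i (rep r) σ
      σ∈r = subst (λ ρ → InBlock k i ρ σ) (lookup-index ρ∈) (InBlock-block σ p)

proposition3 : (n k i : ℕ) → 5 ≤ n → 1 ≤ i → i < n → 2 ≤ k → k < n
    → i ≢ k ∸ 2 → i ≢ k ∸ 1 → i ≢ k → i ≢ k + 1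
    → PrismCover n k i
proposition3 n (suc (suc m)) (suc j) _ _ i<n _ k<n i≢k-2 i≢k-1 i≢k i≢k+1 =
  Blocks.prismCover n m j k<n i<n
    (λ e → i≢k-1 (cong suc e))
    (λ e → i≢k (cong suc e))
    (λ e → i≢k+1 (trans (cong suc e) (cong (λ x → suc (suc x)) (+-comm 1 m))))
    i≢k-2
proposition3 n k zero _ () _ _ _ _ _ _ _
proposition3 n zero (suc j) _ _ _ () _ _ _ _ _
proposition3 n (suc zero) (suc j) _ _ _ (s≤s ()) _ _ _ _ _
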